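{- Let $N$ be a nonzero rational number, let $P$ be a rational point of the elliptic curve $C_N: y^2=x^3-N^2x$, and let $k,m$ be positive integers of the same parity such that $kP$ and $mP$ are not the point at infinity. Then the product $[kP]_x\cdot[mP]_x$ of the $x$-coordinates of $kP$ and $mP$ is the square of a rational number.
   Context: $C_N$ is regarded as an elliptic curve over $\mathbb{Q}$ with the usual group law (chord-and-tangent addition, identity the point at infinity); $kP$ denotes the $k$-fold sum $P\oplus\cdots\oplus P$, and $[Q]_x$ denotes the $x$-coordinate of an affine point $Q$. -}

module Defs where

open import Data.Nat using (ℕ; zero; suc)
open import Data.Rational using (ℚ; 0ℚ; 1ℚ; _+_; _-_; _*_; _÷_; ≢-nonZero)
open import Data.Rational.Properties using (_≟_)
open import Relation.Binary.PropositionalEquality using (_≡_)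
open import Relation.Nullary using (yes; no)

data Pt : Set where
  ∞   : Pt
  aff : ℚ → ℚ → Pt

2ℚ 3ℚ : ℚ
2ℚ = 1ℚ + 1ℚ
3ℚ = 2ℚ + 1ℚ

OnCurve : ℚ → Pt → Set
OnCurve N ∞         = Data.Unit.⊤ where import Data.Unit
OnCurve N (aff x y) = y * y ≡ x * x * x - N * N * x

-- For points on the curve with x₁ = x₂ we have y₂ = ± y₁; if y₁ + y₂ = 0 the sum is ∞,
-- otherwise y₁ = y₂ ≠ 0 and y₁ + y₂ = 2y₁ is the tangent-slope denominator.
add : ℚ → Pt → Pt → Pt
add N ∞ Q = Q
add N (aff x₁ y₁) ∞ = aff x₁ y₁
add N (aff x₁ y₁) (aff x₂ y₂) with x₂ - x₁ ≟ 0ℚ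
... | no d≢0 =
  let instance _ = ≢-nonZero d≢0
      λ' = (y₂ - y₁) ÷ (x₂ - x₁)
      x₃ = λ' * λ' - x₁ - x₂
  in aff x₃ (λ' * (x₁ - x₃) - y₁)
... | yes _ with y₁ + y₂ ≟ 0ℚ
...   | yes _ = ∞
...   | no s≢0 =
  let instance _ = ≢-nonZero s≢0
      λ' = (3ℚ * x₁ * x₁ - N * N) ÷ (y₁ + y₂)
      x₃ = λ' * λ' - 2ℚ * x₁
  in aff x₃ (λ' * (x₁ - x₃) - y₁)

mul : ℚ → ℕ → Pt → Pt
mul N zero    P = ∞
mul N (suc k) P = add N (mul N k P) P

-- Map an affine point of C_N to its x-coordinate (sending (0, 0) to −1) and ∞ to 1, read in
-- ℚ*/ℚ*². If the line y = l x + v meets C_N in x₁, x₂, x₃, comparing constant terms in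
-- x³ − N² x − (l x + v)² = (x − x₁)(x − x₂)(x − x₃) gives x₁ x₂ x₃ = v², so the classes of three
-- collinear points multiply to a square; as P ⊕ Q is the reflection of the third point on the
-- line through P and Q, δ(P) δ(Q) δ(P ⊕ Q) is a square. Applying this to kP ⊕ P and (k+1)P ⊕ P
-- shows that δ((k+2)P) and δ(kP) have the same class, so the class of δ(kP) depends only on
-- the parity of k; for nonzero x-coordinates that is the claim, and a zero one makes the product 0.
module Submission where

open import Level using (0ℓ)
open import Data.Nat as ℕ using (ℕ; zero; suc; _%_)
open import Data.Rational using (ℚ; 0ℚ; 1ℚ; _+_; _-_; -_; _*_; _÷_; 1/_; ≢-nonZero)
open import Data.Rational.Properties
  using (_≟_; +-0-group; +-*-commutativeRing; neg-injective;
         *-assoc; *-comm; *-identityˡ; *-identityʳ; *-zeroˡ; *-zeroʳ; *-inverseˡ; *-inverseʳ)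
open import Algebra.Bundles using (CommutativeRing)
open import Algebra.Properties.Group +-0-group using (x∙y⁻¹≈ε⇒x≈y; x≈y⇒x∙y⁻¹≈ε; inverseˡ-unique)
open import Algebra.Properties.CommutativeSemigroup
  (CommutativeRing.*-commutativeSemigroup +-*-commutativeRing) using (xy∙z≈zx∙y; xy∙z≈yz∙x)
open import Data.List using ([]; _∷_)
open import Data.Product using (∃; _,_; _×_; proj₁; proj₂)
open import Data.Unit using (tt)
open import Data.Empty using (⊥-elim)
open import Relation.Nullary using (yes; no)
open import Relation.Nullary.Decidable using (dec⇒maybe)
open import Relation.Binary.PropositionalEquality
  using (_≡_; _≢_; ≢-sym; refl; sym; trans; cong; cong₂; subst; subst₂; module ≡-Reasoning)
open import Tactic.RingSolver using (solve)
open import Tactic.RingSolver.Core.AlmostCommutativeRing using (AlmostCommutativeRing; fromCommutativeRing)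

open import Defs

open ≡-Reasoning

ring : AlmostCommutativeRing 0ℓ 0ℓ
ring = fromCommutativeRing +-*-commutativeRing (λ x → dec⇒maybe (0ℚ ≟ x))

p*q≡0⇒q≡0 : ∀ {p q} → p ≢ 0ℚ → p * q ≡ 0ℚ → q ≡ 0ℚ
p*q≡0⇒q≡0 {p} {q} p≢0 pq≡0 = begin
  q              ≡⟨ sym (*-identityˡ q) ⟩
  1ℚ * q         ≡⟨ cong (_* q) (sym (*-inverseˡ p)) ⟩
  1/ p * p * q   ≡⟨ *-assoc (1/ p) p q ⟩
  1/ p * (p * q) ≡⟨ cong (1/ p *_) pq≡0 ⟩
  1/ p * 0ℚ      ≡⟨ *-zeroʳ (1/ p) ⟩
  0ℚ             ∎
  where instance _ = ≢-nonZero p≢0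

p*q≢0 : ∀ {p q} → p ≢ 0ℚ → q ≢ 0ℚ → p * q ≢ 0ℚ
p*q≢0 p≢0 q≢0 pq≡0 = q≢0 (p*q≡0⇒q≡0 p≢0 pq≡0)

p*q≢0⇒p≢0 : ∀ {p q} → p * q ≢ 0ℚ → p ≢ 0ℚ
p*q≢0⇒p≢0 {q = q} pq≢0 refl = pq≢0 (*-zeroˡ q)

p*q≢0⇒q≢0 : ∀ {p q} → p * q ≢ 0ℚ → q ≢ 0ℚ
p*q≢0⇒q≢0 {p} pq≢0 refl = pq≢0 (*-zeroʳ p)

p*p≡0⇒p≡0 : ∀ {p} → p * p ≡ 0ℚ → p ≡ 0ℚ
p*p≡0⇒p≡0 {p} pp≡0 with p ≟ 0ℚ
... | yes p≡0 = p≡0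
... | no  p≢0 = p*q≡0⇒q≡0 p≢0 pp≡0

p÷q*q≡p : ∀ p q (q≢0 : q ≢ 0ℚ) → let instance _ = ≢-nonZero q≢0 in (p ÷ q) * q ≡ p
p÷q*q≡p p q q≢0 = begin
  p * 1/ q * q   ≡⟨ *-assoc p (1/ q) q ⟩
  p * (1/ q * q) ≡⟨ cong (p *_) (*-inverseˡ q) ⟩
  p * 1ℚ         ≡⟨ *-identityʳ p ⟩
  p              ∎
  where instance _ = ≢-nonZero q≢0

p*p≡q*q⇒p≡q : ∀ {p q} → p + q ≢ 0ℚ → p * p ≡ q * q → p ≡ q
p*p≡q*q⇒p≡q {p} {q} p+q≢0 pp≡qq = x∙y⁻¹≈ε⇒x≈y p q (p*q≡0⇒q≡0 p+q≢0 (begin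
  (p + q) * (p - q)   ≡⟨ solve (p ∷ q ∷ []) ring ⟩
  p * p - q * q       ≡⟨ x≈y⇒x∙y⁻¹≈ε pp≡qq ⟩
  0ℚ                  ∎))

IsSquare : ℚ → Set
IsSquare a = ∃ λ r → a ≡ r * r

isSquare-* : ∀ {a b} → IsSquare a → IsSquare b → IsSquare (a * b)
isSquare-* (r , refl) (s , refl) = r * s , solve (r ∷ s ∷ []) ring

isSquare-cancel : ∀ {r a} → r ≢ 0ℚ → IsSquare (r * r * a) → IsSquare a
isSquare-cancel {r} {a} r≢0 (s , rra≡ss) = s * 1/ r , (begin
  a                          ≡⟨ solve (a ∷ []) ring ⟩
  1ℚ * 1ℚ * a                ≡⟨ cong (λ t → t * t * a) (sym (*-inverseʳ r)) ⟩
  r * 1/ r * (r * 1/ r) * a  ≡⟨ regroup (1/ r) ⟩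
  r * r * a * (1/ r * 1/ r)  ≡⟨ cong (_* (1/ r * 1/ r)) rra≡ss ⟩
  s * s * (1/ r * 1/ r)      ≡⟨ regroup′ (1/ r) ⟩
  s * 1/ r * (s * 1/ r)      ∎)
  where
  instance _ = ≢-nonZero r≢0
  regroup : ∀ w → r * w * (r * w) * a ≡ r * r * a * (w * w)
  regroup w = solve (r ∷ w ∷ a ∷ []) ring
  regroup′ : ∀ w → s * s * (w * w) ≡ s * w * (s * w)
  regroup′ w = solve (s ∷ w ∷ []) ring

isSquare-trans : ∀ {a b c} → b ≢ 0ℚ → IsSquare (a * b) → IsSquare (b * c) → IsSquare (a * c)
isSquare-trans {a} {b} {c} b≢0 ab bc =
  isSquare-cancel b≢0 (subst IsSquare regroup (isSquare-* ab bc))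
  where
  regroup : a * b * (b * c) ≡ b * b * (a * c)
  regroup = solve (a ∷ b ∷ c ∷ []) ring

-- x = 0 is sent to −1 ≡ −N² mod squares: a line through (0, 0) meets C_N in two more
-- points with x₂ x₃ = −N².
δ : ℚ → ℚ
δ x with x ≟ 0ℚ
... | yes _ = - 1ℚ
... | no  _ = x

δ≢0 : ∀ x → δ x ≢ 0ℚ
δ≢0 x with x ≟ 0ℚ
... | yes _   = λ ()
... | no  x≢0 = x≢0

δ-nonzero : ∀ {x} → x ≢ 0ℚ → δ x ≡ x
δ-nonzero {x} x≢0 with x ≟ 0ℚ
... | yes x≡0 = ⊥-elim (x≢0 x≡0)
... | no  _   = refl

δₚ : Pt → ℚ
δₚ ∞         = 1ℚ
δₚ (aff x _) = δ x

δₚ≢0 : ∀ P → δₚ P ≢ 0ℚ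
δₚ≢0 ∞         ()
δₚ≢0 (aff x _) = δ≢0 x

-- The line y = l x + v meets C_N in x₁, x₂, x₃ (with multiplicity), i.e.
-- x³ − N² x − (l x + v)² = (x − x₁)(x − x₂)(x − x₃).
record Vieta (N l v x₁ x₂ x₃ : ℚ) : Set where
  field
    σ₁ : x₁ + x₂ + x₃ ≡ l * l
    σ₂ : x₁ * x₂ + x₂ * x₃ + x₃ * x₁ ≡ - (N * N + 2ℚ * l * v)
    σ₃ : x₁ * x₂ * x₃ ≡ v * v

vieta-rotate : ∀ {N l v x₁ x₂ x₃} → Vieta N l v x₁ x₂ x₃ → Vieta N l v x₂ x₃ x₁
vieta-rotate {x₁ = x₁} {x₂} {x₃} V = record
  { σ₁ = trans rotate₁ σ₁
  ; σ₂ = trans rotate₂ σ₂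
  ; σ₃ = trans rotate₃ σ₃
  }
  where
  open Vieta V
  rotate₁ : x₂ + x₃ + x₁ ≡ x₁ + x₂ + x₃
  rotate₁ = solve (x₁ ∷ x₂ ∷ x₃ ∷ []) ring
  rotate₂ : x₂ * x₃ + x₃ * x₁ + x₁ * x₂ ≡ x₁ * x₂ + x₂ * x₃ + x₃ * x₁
  rotate₂ = solve (x₁ ∷ x₂ ∷ x₃ ∷ []) ring
  rotate₃ : x₂ * x₃ * x₁ ≡ x₁ * x₂ * x₃
  rotate₃ = solve (x₁ ∷ x₂ ∷ x₃ ∷ []) ring

vieta⇒onCurve : ∀ {N l v x₁ x₂ x₃} → Vieta N l v x₁ x₂ x₃ → OnCurve N (aff x₃ (- (l * x₃ + v)))
vieta⇒onCurve {N} {l} {v} {x₁} {x₂} {x₃} V = sym (begin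
  x₃ * x₃ * x₃ - N * N * x₃
    ≡⟨ solve (N ∷ x₁ ∷ x₂ ∷ x₃ ∷ []) ring ⟩
  (x₁ + x₂ + x₃) * x₃ * x₃ - (x₁ * x₂ + x₂ * x₃ + x₃ * x₁) * x₃ + x₁ * x₂ * x₃ - N * N * x₃
    ≡⟨ cong₂ (λ s₁ s₂ → s₁ * x₃ * x₃ - s₂ * x₃ + x₁ * x₂ * x₃ - N * N * x₃) σ₁ σ₂ ⟩
  l * l * x₃ * x₃ - - (N * N + 2ℚ * l * v) * x₃ + x₁ * x₂ * x₃ - N * N * x₃
    ≡⟨ cong (λ s₃ → l * l * x₃ * x₃ - - (N * N + 2ℚ * l * v) * x₃ + s₃ - N * N * x₃) σ₃ ⟩
  l * l * x₃ * x₃ - - (N * N + 2ℚ * l * v) * x₃ + v * v - N * N * x₃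
    ≡⟨ solve (N ∷ l ∷ v ∷ x₃ ∷ []) ring ⟩
  - (l * x₃ + v) * - (l * x₃ + v) ∎)
  where open Vieta V

vieta-zero⇒δ-square : ∀ {N l v x₂ x₃} → N ≢ 0ℚ → Vieta N l v 0ℚ x₂ x₃ → IsSquare (δ 0ℚ * δ x₂ * δ x₃)
vieta-zero⇒δ-square {N} {l} {v} {x₂} {x₃} N≢0 V = N , (begin
  δ 0ℚ * δ x₂ * δ x₃  ≡⟨ cong₂ (λ s t → - 1ℚ * s * t) (δ-nonzero x₂≢0) (δ-nonzero x₃≢0) ⟩
  - 1ℚ * x₂ * x₃      ≡⟨ *-assoc (- 1ℚ) x₂ x₃ ⟩
  - 1ℚ * (x₂ * x₃)    ≡⟨ cong (- 1ℚ *_) x₂x₃≡-N² ⟩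
  - 1ℚ * - (N * N)    ≡⟨ solve (N ∷ []) ring ⟩
  N * N               ∎)
  where
  open Vieta V
  v≡0 : v ≡ 0ℚ
  v≡0 = p*p≡0⇒p≡0 (trans (sym σ₃) (trans (cong (_* x₃) (*-zeroˡ x₂)) (*-zeroˡ x₃)))
  x₂x₃≡-N² : x₂ * x₃ ≡ - (N * N)
  x₂x₃≡-N² = begin
    x₂ * x₃                      ≡⟨ solve (x₂ ∷ x₃ ∷ []) ring ⟩
    0ℚ * x₂ + x₂ * x₃ + x₃ * 0ℚ  ≡⟨ σ₂ ⟩
    - (N * N + 2ℚ * l * v)       ≡⟨ cong (λ t → - (N * N + 2ℚ * l * t)) v≡0 ⟩
    - (N * N + 2ℚ * l * 0ℚ)      ≡⟨ solve (N ∷ l ∷ []) ring ⟩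
    - (N * N)                    ∎
  x₂x₃≢0 : x₂ * x₃ ≢ 0ℚ
  x₂x₃≢0 x₂x₃≡0 = N≢0 (p*p≡0⇒p≡0 (neg-injective (trans (sym x₂x₃≡-N²) x₂x₃≡0)))
  x₂≢0 : x₂ ≢ 0ℚ
  x₂≢0 = p*q≢0⇒p≢0 {q = x₃} x₂x₃≢0
  x₃≢0 : x₃ ≢ 0ℚ
  x₃≢0 = p*q≢0⇒q≢0 {x₂} x₂x₃≢0

-- Deciding 0ℚ ≟ xᵢ rather than xᵢ ≟ 0ℚ keeps `with` from abstracting inside δ xᵢ.
vieta⇒δ-square : ∀ {N l v x₁ x₂ x₃} → N ≢ 0ℚ → Vieta N l v x₁ x₂ x₃ → IsSquare (δ x₁ * δ x₂ * δ x₃)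
vieta⇒δ-square {v = v} {x₁} {x₂} {x₃} N≢0 V with 0ℚ ≟ x₁ | 0ℚ ≟ x₂ | 0ℚ ≟ x₃
... | yes refl | _        | _        = vieta-zero⇒δ-square N≢0 V
... | no _     | yes refl | _        =
  subst IsSquare (xy∙z≈zx∙y (δ 0ℚ) (δ x₃) (δ x₁)) (vieta-zero⇒δ-square N≢0 (vieta-rotate V))
... | no _     | no _     | yes refl =
  subst IsSquare (xy∙z≈yz∙x (δ 0ℚ) (δ x₁) (δ x₂)) (vieta-zero⇒δ-square N≢0 (vieta-rotate (vieta-rotate V)))
... | no 0≢x₁  | no 0≢x₂  | no 0≢x₃  = v , (begin
  δ x₁ * δ x₂ * δ x₃  ≡⟨ cong₂ (λ s t → s * t * δ x₃) (δ-nonzero (≢-sym 0≢x₁)) (δ-nonzero (≢-sym 0≢x₂)) ⟩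
  x₁ * x₂ * δ x₃      ≡⟨ cong (x₁ * x₂ *_) (δ-nonzero (≢-sym 0≢x₃)) ⟩
  x₁ * x₂ * x₃        ≡⟨ Vieta.σ₃ V ⟩
  v * v               ∎)

cubic : ℚ → ℚ → ℚ → ℚ → ℚ
cubic N l v x = x * x * x - N * N * x - (l * x + v) * (l * x + v)

cubic′ : ℚ → ℚ → ℚ → ℚ → ℚ
cubic′ N l v x = 3ℚ * x * x - N * N - 2ℚ * l * (l * x + v)

onLine⇒cubic-root : ∀ {N l v x y} → OnCurve N (aff x y) → y ≡ l * x + v → cubic N l v x ≡ 0ℚ
onLine⇒cubic-root y²≡x³-N²x refl = x≈y⇒x∙y⁻¹≈ε (sym y²≡x³-N²x)

secant-vieta : ∀ {N l v x₁ x₂} → x₂ - x₁ ≢ 0ℚ → cubic N l v x₁ ≡ 0ℚ → cubic N l v x₂ ≡ 0ℚ →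
  Vieta N l v x₁ x₂ (l * l - x₁ - x₂)
secant-vieta {N} {l} {v} {x₁} {x₂} Δ≢0 f₁≡0 f₂≡0 = record
  { σ₁ = solve (l ∷ x₁ ∷ x₂ ∷ []) ring
  ; σ₂ = inverseˡ-unique _ _ (p*q≡0⇒q≡0 Δ≢0 (begin
      (x₂ - x₁) * (x₁ * x₂ + x₂ * (l * l - x₁ - x₂) + (l * l - x₁ - x₂) * x₁ + (N * N + 2ℚ * l * v))
        ≡⟨ solve (N ∷ l ∷ v ∷ x₁ ∷ x₂ ∷ []) ring ⟩
      (x₁ * x₁ * x₁ - N * N * x₁ - (l * x₁ + v) * (l * x₁ + v))
        - (x₂ * x₂ * x₂ - N * N * x₂ - (l * x₂ + v) * (l * x₂ + v))
        ≡⟨ cong₂ _-_ f₁≡0 f₂≡0 ⟩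
      0ℚ - 0ℚ
        ≡⟨⟩
      0ℚ ∎))
  ; σ₃ = x∙y⁻¹≈ε⇒x≈y _ _ (p*q≡0⇒q≡0 Δ≢0 (begin
      (x₂ - x₁) * (x₁ * x₂ * (l * l - x₁ - x₂) - v * v)
        ≡⟨ solve (N ∷ l ∷ v ∷ x₁ ∷ x₂ ∷ []) ring ⟩
      x₂ * (x₁ * x₁ * x₁ - N * N * x₁ - (l * x₁ + v) * (l * x₁ + v))
        - x₁ * (x₂ * x₂ * x₂ - N * N * x₂ - (l * x₂ + v) * (l * x₂ + v))
        ≡⟨ cong₂ (λ s t → x₂ * s - x₁ * t) f₁≡0 f₂≡0 ⟩
      x₂ * 0ℚ - x₁ * 0ℚ
        ≡⟨ solve (x₁ ∷ x₂ ∷ []) ring ⟩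
      0ℚ ∎))
  }

tangent-vieta : ∀ {N l v x₁} → cubic N l v x₁ ≡ 0ℚ → cubic′ N l v x₁ ≡ 0ℚ →
  Vieta N l v x₁ x₁ (l * l - 2ℚ * x₁)
tangent-vieta {N} {l} {v} {x₁} f≡0 f′≡0 = record
  { σ₁ = solve (l ∷ x₁ ∷ []) ring
  ; σ₂ = inverseˡ-unique _ _ (begin
      x₁ * x₁ + x₁ * (l * l - 2ℚ * x₁) + (l * l - 2ℚ * x₁) * x₁ + (N * N + 2ℚ * l * v)
        ≡⟨ solve (N ∷ l ∷ v ∷ x₁ ∷ []) ring ⟩
      - (3ℚ * x₁ * x₁ - N * N - 2ℚ * l * (l * x₁ + v))
        ≡⟨ cong -_ f′≡0 ⟩
      0ℚ ∎)
  ; σ₃ = x∙y⁻¹≈ε⇒x≈y _ _ (begin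
      x₁ * x₁ * (l * l - 2ℚ * x₁) - v * v
        ≡⟨ solve (N ∷ l ∷ v ∷ x₁ ∷ []) ring ⟩
      (x₁ * x₁ * x₁ - N * N * x₁ - (l * x₁ + v) * (l * x₁ + v))
        - x₁ * (3ℚ * x₁ * x₁ - N * N - 2ℚ * l * (l * x₁ + v))
        ≡⟨ cong₂ (λ s t → s - x₁ * t) f≡0 f′≡0 ⟩
      0ℚ - x₁ * 0ℚ
        ≡⟨ solve (x₁ ∷ []) ring ⟩
      0ℚ ∎)
  }

onCurve⇒cubic-root : ∀ {N x y} l → OnCurve N (aff x y) → cubic N l (y - l * x) x ≡ 0ℚ
onCurve⇒cubic-root {N} {x} {y} l P∈C =
  onLine⇒cubic-root {N} {l} {y - l * x} {x} {y} P∈C (solve (l ∷ x ∷ y ∷ []) ring)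

secant-line : ∀ {l x₁ y₁ x₂ y₂} → l * (x₂ - x₁) ≡ y₂ - y₁ → y₂ ≡ l * x₂ + (y₁ - l * x₁)
secant-line {l} {x₁} {y₁} {x₂} {y₂} slope = begin
  y₂                      ≡⟨ solve (y₁ ∷ y₂ ∷ []) ring ⟩
  y₂ - y₁ + y₁            ≡⟨ cong (_+ y₁) (sym slope) ⟩
  l * (x₂ - x₁) + y₁      ≡⟨ solve (l ∷ x₁ ∷ y₁ ∷ x₂ ∷ []) ring ⟩
  l * x₂ + (y₁ - l * x₁)  ∎

tangent-slope⇒cubic′-root : ∀ {N l x y} → l * (y + y) ≡ 3ℚ * x * x - N * N →
  cubic′ N l (y - l * x) x ≡ 0ℚ
tangent-slope⇒cubic′-root {N} {l} {x} {y} slope = begin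
  3ℚ * x * x - N * N - 2ℚ * l * (l * x + (y - l * x))  ≡⟨ solve (N ∷ l ∷ x ∷ y ∷ []) ring ⟩
  3ℚ * x * x - N * N - l * (y + y)                     ≡⟨ x≈y⇒x∙y⁻¹≈ε (sym slope) ⟩
  0ℚ                                                   ∎

vieta⇒add-onCurve×δ-square : ∀ {N l x₁ y₁ x₂ x₃} → N ≢ 0ℚ → Vieta N l (y₁ - l * x₁) x₁ x₂ x₃ →
  OnCurve N (aff x₃ (l * (x₁ - x₃) - y₁)) × IsSquare (δ x₁ * δ x₂ * δ x₃)
vieta⇒add-onCurve×δ-square {N} {l} {x₁} {y₁} {x₂} {x₃} N≢0 V =
  subst (λ y → OnCurve N (aff x₃ y)) reflection (vieta⇒onCurve V) , vieta⇒δ-square N≢0 V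
  where
  reflection : - (l * x₃ + (y₁ - l * x₁)) ≡ l * (x₁ - x₃) - y₁
  reflection = solve (l ∷ x₁ ∷ y₁ ∷ x₃ ∷ []) ring

add-onCurve×δ-square : ∀ {N} → N ≢ 0ℚ → ∀ P Q → OnCurve N P → OnCurve N Q →
  OnCurve N (add N P Q) × IsSquare (δₚ P * δₚ Q * δₚ (add N P Q))
add-onCurve×δ-square N≢0 ∞ Q _ Q∈C = Q∈C , δₚ Q , cong (_* δₚ Q) (*-identityˡ (δₚ Q))
add-onCurve×δ-square N≢0 (aff x₁ y₁) ∞ P∈C _ = P∈C , δ x₁ , cong (_* δ x₁) (*-identityʳ (δ x₁))
add-onCurve×δ-square {N} N≢0 (aff x₁ y₁) (aff x₂ y₂) P∈C Q∈C with x₂ - x₁ ≟ 0ℚ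
... | no Δ≢0 = vieta⇒add-onCurve×δ-square {N} {l} {x₁} {y₁} {x₂} N≢0
      (secant-vieta {N} {l} {y₁ - l * x₁} {x₁} {x₂} Δ≢0
        (onCurve⇒cubic-root {N} {x₁} {y₁} l P∈C)
        (onLine⇒cubic-root {N} {l} {y₁ - l * x₁} {x₂} {y₂} Q∈C
          (secant-line {l} {x₁} {y₁} {x₂} {y₂} (p÷q*q≡p (y₂ - y₁) (x₂ - x₁) Δ≢0))))
  where
  instance _ = ≢-nonZero Δ≢0
  l : ℚ
  l = (y₂ - y₁) ÷ (x₂ - x₁)
... | yes Δ≡0 with x∙y⁻¹≈ε⇒x≈y x₂ x₁ Δ≡0
...   | refl with y₁ + y₂ ≟ 0ℚ
...     | yes _ = tt , δ x₁ , *-identityʳ (δ x₁ * δ x₁)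
...     | no Σ≢0 = vieta⇒add-onCurve×δ-square {N} {l} {x₁} {y₁} {x₁} N≢0
      (tangent-vieta {N} {l} {y₁ - l * x₁} {x₁}
        (onCurve⇒cubic-root {N} {x₁} {y₁} l P∈C)
        (tangent-slope⇒cubic′-root {N} {l} {x₁} {y₁} (begin
          l * (y₁ + y₁)   ≡⟨ cong (λ y → l * (y₁ + y)) y₁≡y₂ ⟩
          l * (y₁ + y₂)   ≡⟨ p÷q*q≡p (3ℚ * x₁ * x₁ - N * N) (y₁ + y₂) Σ≢0 ⟩
          3ℚ * x₁ * x₁ - N * N ∎)))
  where
  instance _ = ≢-nonZero Σ≢0
  l : ℚ
  l = (3ℚ * x₁ * x₁ - N * N) ÷ (y₁ + y₂)
  y₁≡y₂ : y₁ ≡ y₂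
  y₁≡y₂ = p*p≡q*q⇒p≡q {y₁} {y₂} Σ≢0 (trans P∈C (sym Q∈C))

mul-onCurve : ∀ {N P} → N ≢ 0ℚ → OnCurve N P → ∀ k → OnCurve N (mul N k P)
mul-onCurve N≢0 P∈C zero    = tt
mul-onCurve {P = P} N≢0 P∈C (suc k) =
  proj₁ (add-onCurve×δ-square N≢0 _ P (mul-onCurve N≢0 P∈C k) P∈C)

δ-mul-suc : ∀ {N P} → N ≢ 0ℚ → OnCurve N P → ∀ k →
  IsSquare (δₚ (mul N k P) * δₚ P * δₚ (mul N (suc k) P))
δ-mul-suc {P = P} N≢0 P∈C k = proj₂ (add-onCurve×δ-square N≢0 _ P (mul-onCurve N≢0 P∈C k) P∈C)

δ-mul-suc-suc : ∀ {N P} → N ≢ 0ℚ → OnCurve N P → ∀ k →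
  IsSquare (δₚ (mul N k P) * δₚ (mul N (suc (suc k)) P))
δ-mul-suc-suc {N} {P} N≢0 P∈C k = isSquare-trans {δₚ Q₀} {c = δₚ Q₂} (p*q≢0 (δₚ≢0 P) (δₚ≢0 Q₁))
  (subst IsSquare (*-assoc (δₚ Q₀) (δₚ P) (δₚ Q₁)) (δ-mul-suc N≢0 P∈C k))
  (subst IsSquare (cong (_* δₚ Q₂) (*-comm (δₚ Q₁) (δₚ P))) (δ-mul-suc N≢0 P∈C (suc k)))
  where
  Q₀ Q₁ Q₂ : Pt
  Q₀ = mul N k P
  Q₁ = mul N (suc k) P
  Q₂ = mul N (suc (suc k)) P

δ-mul-mod2 : ∀ {N P} → N ≢ 0ℚ → OnCurve N P → ∀ k → IsSquare (δₚ (mul N k P) * δₚ (mul N (k % 2) P))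
δ-mul-mod2         N≢0 P∈C zero          = 1ℚ , refl
δ-mul-mod2 {P = P} N≢0 P∈C (suc zero)    = δₚ P , refl
δ-mul-mod2 {N} {P} N≢0 P∈C (suc (suc k)) = isSquare-trans {δₚ (mul N (suc (suc k)) P)} (δₚ≢0 (mul N k P))
  (subst IsSquare (*-comm (δₚ (mul N k P)) _) (δ-mul-suc-suc N≢0 P∈C k))
  (δ-mul-mod2 N≢0 P∈C k)

δ-mul-parity : ∀ {N P} → N ≢ 0ℚ → OnCurve N P → ∀ k m → k % 2 ≡ m % 2 →
  IsSquare (δₚ (mul N k P) * δₚ (mul N m P))
δ-mul-parity {N} {P} N≢0 P∈C k m k≡m =
  isSquare-trans {δₚ (mul N k P)} {c = δₚ (mul N m P)} (δₚ≢0 (mul N (k % 2) P))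
  (δ-mul-mod2 N≢0 P∈C k)
  (subst (λ i → IsSquare (δₚ (mul N i P) * δₚ (mul N m P))) (sym k≡m)
    (subst IsSquare (*-comm (δₚ (mul N m P)) _) (δ-mul-mod2 N≢0 P∈C m)))

δₚ-aff : ∀ {Q x y} → Q ≡ aff x y → x ≢ 0ℚ → δₚ Q ≡ x
δₚ-aff refl x≢0 = δ-nonzero x≢0

mainTheorem9 : (N : ℚ) → N ≢ 0ℚ → (P : Pt) → OnCurve N P →
    (k m : ℕ) → 1 ℕ.≤ k → 1 ℕ.≤ m → k % 2 ≡ m % 2 →
    (xk yk xm ym : ℚ) → mul N k P ≡ aff xk yk → mul N m P ≡ aff xm ym →
    ∃ λ (r : ℚ) → xk * xm ≡ r * r
mainTheorem9 N N≢0 P P∈C k m _ _ k≡m xk yk xm ym kP≡ mP≡ with xk ≟ 0ℚ | xm ≟ 0ℚ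
... | yes refl | _        = 0ℚ , *-zeroˡ xm
... | no _     | yes refl = 0ℚ , *-zeroʳ xk
... | no xk≢0  | no xm≢0  = subst₂ (λ a b → IsSquare (a * b))
  (δₚ-aff kP≡ xk≢0) (δₚ-aff mP≡ xm≢0) (δ-mul-parity N≢0 P∈C k m k≡m)
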